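{- If $n\ge 2$, then $WL(W_{2^n},Q_n)=(n+2)2^{n-1}$.
   Context: $Q_n$ is the $n$-dimensional hypercube: vertex set $\{0,1\}^n$, two vertices adjacent iff they differ in exactly one coordinate. For $m\ge 4$, the wheel $W_m$ of order $m$ is obtained from a cycle $C_{m-1}$ by adding a new vertex (the hub) adjacent to all vertices of the cycle. An embedding of a graph $G$ into a graph $H$ is a pair $(f,P_f)$ where $f:V(G)\to V(H)$ is injective and $P_f$ assigns to each edge $uv\in E(G)$ a path in $H$ between $f(u)$ and $f(v)$. The wirelength of the embedding is $WL_f(G,H)=\sum_{e\in E(G)}|P_f(e)|$, and $WL(G,H)$ is the minimum of $WL_f(G,H)$ over all embeddings of $G$ into $H$. -}

module Defs where

open import Data.Nat using (ℕ; zero; suc; _+_; _∸_; _≤_)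
open import Data.Bool using (Bool; true; false)
open import Data.Fin using (Fin; zero; suc; inject₁; fromℕ)
open import Data.Vec using (Vec; []; _∷_)
open import Data.List using (List; []; _∷_; map; _++_; [_]; allFin; length)
open import Data.List.Relation.Unary.All using (All; []; _∷_)
open import Data.List.Relation.Unary.Unique.Propositional using (Unique)
open import Data.Product using (_×_; _,_; proj₁; proj₂; Σ; ∃)
open import Relation.Binary.PropositionalEquality using (_≡_)
open import Function.Definitions using (Injective)

QVertex : ℕ → Set
QVertex n = Vec Bool n

diff : Bool → Bool → ℕ
diff true  true  = 0
diff false false = 0
diff true  false = 1
diff false true  = 1

hamming : ∀ {n} → QVertex n → QVertex n → ℕ
hamming []       []       = 0
hamming (x ∷ xs) (y ∷ ys) = diff x y + hamming xs ys

QAdj : ∀ {n} → QVertex n → QVertex n → Set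
QAdj u v = hamming u v ≡ 1

data Walk {n : ℕ} : QVertex n → QVertex n → Set where
  []  : ∀ {u} → Walk u u
  _∷_ : ∀ {u v w} → QAdj u v → Walk v w → Walk u w

walkVertices : ∀ {n} {u v : QVertex n} → Walk u v → List (QVertex n)
walkVertices {u = u} []       = u ∷ []
walkVertices {u = u} (_ ∷ w)  = u ∷ walkVertices w

walkLength : ∀ {n} {u v : QVertex n} → Walk u v → ℕ
walkLength []      = 0
walkLength (_ ∷ w) = suc (walkLength w)

QPath : ∀ {n} → QVertex n → QVertex n → Set
QPath u v = Σ (Walk u v) (λ w → Unique (walkVertices w))

pathLength : ∀ {n} {u v : QVertex n} → QPath u v → ℕ
pathLength (w , _) = walkLength w

-- Guest graphs: vertex set Fin m, edge set given as a list of
-- unordered edges (each edge listed once, as an ordered pair).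

EdgeList : ℕ → Set
EdgeList m = List (Fin m × Fin m)

-- Cycle on vertices 0,1,...,j (j+1 vertices): edges i~i+1 and j~0.
cycleEdges : (j : ℕ) → EdgeList (suc j)
cycleEdges j = map (λ i → inject₁ i , suc i) (allFin j) ++ [ (fromℕ j , zero) ]

-- Wheel of order m = j + 2 : hub = vertex 0, cycle C_{j+1} on the
-- vertices 1,...,j+1; the hub is adjacent to every cycle vertex.
wheelEdges : (j : ℕ) → EdgeList (suc (suc j))
wheelEdges j =
  map (λ i → zero , suc i) (allFin (suc j))
  ++ map (λ e → suc (proj₁ e) , suc (proj₂ e)) (cycleEdges j)

record Embedding {m : ℕ} (E : EdgeList m) (n : ℕ) : Set where
  field
    f     : Fin m → QVertex n
    f-inj : Injective _≡_ _≡_ f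
    P     : All (λ e → QPath (f (proj₁ e)) (f (proj₂ e))) E

sumLengths : ∀ {m n} {f : Fin m → QVertex n} {E : EdgeList m} →
             All (λ e → QPath (f (proj₁ e)) (f (proj₂ e))) E → ℕ
sumLengths []       = 0
sumLengths (p ∷ ps) = pathLength p + sumLengths ps

wirelength : ∀ {m n} {E : EdgeList m} → Embedding E n → ℕ
wirelength emb = sumLengths (Embedding.P emb)

WLis : ∀ {m} → EdgeList m → ℕ → ℕ → Set
WLis E n k = (Σ (Embedding E n) (λ emb → wirelength emb ≡ k))
           × ((emb : Embedding E n) → k ≤ wirelength emb)

module Submission where

-- A path between f u and f v is at least as long as their Hamming distance, so an embedding
-- costs at least the sum of these distances over the edges.  Since f is a bijection onto Q_n,
-- the spokes cost the total distance from the hub to all vertices, n·2^(n-1): in every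
-- coordinate half of the vertices disagree with the hub.  The rim is a cycle on the odd number
-- 2^n − 1 of vertices, while closed walks in the bipartite Q_n have even length, so the rim
-- costs at least 2^n.  The reflected Gray code attains both bounds: with its first word as the
-- hub, consecutive rim vertices are adjacent and both ends of the rim are adjacent to the hub,
-- so the rim closes with a single edge of length 2.

open import Defs
open import Data.Nat using (ℕ; zero; suc; _+_; _*_; _∸_; _^_; _≤_; _<_; _≮_; z≤n; s≤s; _<?_; parity)
open import Data.Nat.Properties
open import Data.Nat.ListAction using (sum)
open import Data.Nat.ListAction.Properties using (sum-++)
open import Data.Nat.Tactic.RingSolver using (solve-∀)
open import Data.Parity.Base as ℙ using (Parity; 0ℙ; 1ℙ)
import Data.Parity.Properties as ℙ
open import Algebra.Properties.CommutativeSemigroup +-commutativeSemigroup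
  using () renaming (interchange to +-interchange)
open import Algebra.Properties.CommutativeSemigroup ℙ.+-commutativeSemigroup
  using () renaming (interchange to ℙ+-interchange)
open import Data.Bool using (Bool; true; false; not)
import Data.Bool.Properties as Bool
open import Data.Fin using (Fin; zero; suc; inject₁; fromℕ; toℕ)
open import Data.Fin.Properties as Fin using (toℕ-injective; toℕ<n; toℕ-fromℕ; toℕ-inject₁)
open import Data.Vec using ([]; _∷_; head)
open import Data.List using (List; []; _∷_; length; map; tabulate; _++_; [_]; allFin)
open import Data.List.Properties using (length-tabulate; map-tabulate; map-++; map-∘)
open import Data.List.Relation.Unary.All using (All; []; _∷_; universal)
open import Data.List.Relation.Unary.AllPairs using ([]; _∷_)
open import Data.List.Relation.Unary.Unique.Propositional using (Unique)
import Data.List.Relation.Unary.Unique.Propositional.Properties as Unique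
open import Data.Product using (_×_; _,_; proj₁; proj₂; Σ)
open import Data.Sum using (inj₁; inj₂)
open import Function using (_∘_)
open import Function.Definitions using (Injective)
open import Relation.Nullary using (yes; no)
open import Relation.Nullary.Negation using (contradiction)
open import Relation.Binary.PropositionalEquality hiding ([_])

private
  variable
    m n j : ℕ

diff-refl : ∀ a → diff a a ≡ 0
diff-refl true  = refl
diff-refl false = refl

diff-sym : ∀ a b → diff a b ≡ diff b a
diff-sym true  true  = refl
diff-sym true  false = refl
diff-sym false true  = refl
diff-sym false false = refl

diff-≢ : ∀ {a b} → a ≢ b → diff a b ≡ 1
diff-≢ {true}  {true}  a≢b = contradiction refl a≢b
diff-≢ {true}  {false} _   = refl
diff-≢ {false} {true}  _   = refl
diff-≢ {false} {false} a≢b = contradiction refl a≢b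

diff-triangle : ∀ a b c → diff a c ≤ diff a b + diff b c
diff-triangle true  true  c     = ≤-refl
diff-triangle false false c     = ≤-refl
diff-triangle true  false true  = z≤n
diff-triangle true  false false = s≤s z≤n
diff-triangle false true  true  = s≤s z≤n
diff-triangle false true  false = z≤n

hamming-refl : (u : QVertex n) → hamming u u ≡ 0
hamming-refl []      = refl
hamming-refl (a ∷ u) = cong₂ _+_ (diff-refl a) (hamming-refl u)

hamming-sym : (u v : QVertex n) → hamming u v ≡ hamming v u
hamming-sym []      []      = refl
hamming-sym (a ∷ u) (b ∷ v) = cong₂ _+_ (diff-sym a b) (hamming-sym u v)

hamming≡0⇒≡ : (u v : QVertex n) → hamming u v ≡ 0 → u ≡ v
hamming≡0⇒≡ []          []          _ = refl
hamming≡0⇒≡ (true ∷ u)  (true ∷ v)  e = cong (true ∷_) (hamming≡0⇒≡ u v e)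
hamming≡0⇒≡ (false ∷ u) (false ∷ v) e = cong (false ∷_) (hamming≡0⇒≡ u v e)

≢⇒hamming≥1 : (u v : QVertex n) → u ≢ v → 1 ≤ hamming u v
≢⇒hamming≥1 u v u≢v with hamming u v in eq
... | zero  = contradiction (hamming≡0⇒≡ u v eq) u≢v
... | suc _ = s≤s z≤n

hamming-triangle : (u v w : QVertex n) → hamming u w ≤ hamming u v + hamming v w
hamming-triangle []      []      []      = z≤n
hamming-triangle (a ∷ u) (b ∷ v) (c ∷ w) = begin
  diff a c + hamming u w
    ≤⟨ +-mono-≤ (diff-triangle a b c) (hamming-triangle u v w) ⟩
  (diff a b + diff b c) + (hamming u v + hamming v w)
    ≡⟨ +-interchange (diff a b) (diff b c) (hamming u v) (hamming v w) ⟩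
  (diff a b + hamming u v) + (diff b c + hamming v w) ∎
  where open ≤-Reasoning

-- Walks, and geodesic paths realising the Hamming distance

hamming≤walkLength : {u v : QVertex n} (w : Walk u v) → hamming u v ≤ walkLength w
hamming≤walkLength {u = u} []                     = ≤-reflexive (hamming-refl u)
hamming≤walkLength {u = u} {v} (_∷_ {v = x} u~x w) = begin
  hamming u v               ≤⟨ hamming-triangle u x v ⟩
  hamming u x + hamming x v ≡⟨ cong (_+ hamming x v) u~x ⟩
  suc (hamming x v)         ≤⟨ s≤s (hamming≤walkLength w) ⟩
  suc (walkLength w)        ∎
  where open ≤-Reasoning

consWalk : (b : Bool) {u v : QVertex n} → Walk u v → Walk (b ∷ u) (b ∷ v)
consWalk b []                          = []
consWalk b (_∷_ {u = x} {v = y} x~y w) = trans (cong (_+ hamming x y) (diff-refl b)) x~y ∷ consWalk b w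

walkVertices-consWalk : (b : Bool) {u v : QVertex n} (w : Walk u v) →
                        walkVertices (consWalk b w) ≡ map (b ∷_) (walkVertices w)
walkVertices-consWalk b []      = refl
walkVertices-consWalk b (_ ∷ w) = cong (_ ∷_) (walkVertices-consWalk b w)

walkLength-consWalk : (b : Bool) {u v : QVertex n} (w : Walk u v) →
                      walkLength (consWalk b w) ≡ walkLength w
walkLength-consWalk b []      = refl
walkLength-consWalk b (_ ∷ w) = cong suc (walkLength-consWalk b w)

∷-injectiveʳ : ∀ {b : Bool} {u v : QVertex n} → _≡_ {A = QVertex (suc n)} (b ∷ u) (b ∷ v) → u ≡ v
∷-injectiveʳ refl = refl

unique-consWalk : (b : Bool) {u v : QVertex n} (w : Walk u v) →
                  Unique (walkVertices w) → Unique (walkVertices (consWalk b w))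
unique-consWalk b w uniq =
  subst Unique (sym (walkVertices-consWalk b w)) (Unique.map⁺ ∷-injectiveʳ uniq)

∉-map-∷ : ∀ {a b : Bool} (u : QVertex n) → a ≢ b → (vs : List (QVertex n)) →
          All ((a ∷ u) ≢_) (map (b ∷_) vs)
∉-map-∷ u a≢b []       = []
∉-map-∷ u a≢b (v ∷ vs) = (λ e → a≢b (cong head e)) ∷ ∉-map-∷ u a≢b vs

geodesic : (u v : QVertex n) → Σ (QPath u v) (λ p → pathLength p ≡ hamming u v)
geodesic []      []      = ([] , [] ∷ []) , refl
geodesic (a ∷ u) (b ∷ v) with geodesic u v | a Bool.≟ b
... | (w , uniq) , len | yes refl =
  (consWalk a w , unique-consWalk a w uniq) ,
  trans (walkLength-consWalk a w) (trans len (cong (_+ hamming u v) (sym (diff-refl a))))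
... | (w , uniq) , len | no a≢b =
  (flip ∷ consWalk b w ,
   subst (All ((a ∷ u) ≢_)) (sym (walkVertices-consWalk b w)) (∉-map-∷ u a≢b (walkVertices w))
     ∷ unique-consWalk b w uniq) ,
  trans (cong suc (trans (walkLength-consWalk b w) len)) (cong (_+ hamming u v) (sym (diff-≢ a≢b)))
  where
  flip : QAdj (a ∷ u) (b ∷ u)
  flip = cong₂ _+_ (diff-≢ a≢b) (hamming-refl u)

bitParity : Bool → Parity
bitParity false = 0ℙ
bitParity true  = 1ℙ

vertexParity : QVertex n → Parity
vertexParity []      = 0ℙ
vertexParity (b ∷ v) = bitParity b ℙ.+ vertexParity v

parity-diff : ∀ a b → parity (diff a b) ≡ bitParity a ℙ.+ bitParity b
parity-diff true  true  = refl
parity-diff true  false = refl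
parity-diff false true  = refl
parity-diff false false = refl

parity-hamming : (u v : QVertex n) → parity (hamming u v) ≡ vertexParity u ℙ.+ vertexParity v
parity-hamming []      []      = refl
parity-hamming (a ∷ u) (b ∷ v) = begin
  parity (diff a b + hamming u v)            ≡⟨ ℙ.+-homo-+ (diff a b) (hamming u v) ⟩
  parity (diff a b) ℙ.+ parity (hamming u v) ≡⟨ cong₂ ℙ._+_ (parity-diff a b) (parity-hamming u v) ⟩
  (bitParity a ℙ.+ bitParity b) ℙ.+ (vertexParity u ℙ.+ vertexParity v)
    ≡⟨ ℙ+-interchange (bitParity a) (bitParity b) (vertexParity u) (vertexParity v) ⟩
  (bitParity a ℙ.+ vertexParity u) ℙ.+ (bitParity b ℙ.+ vertexParity v) ∎
  where open ≡-Reasoning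

distanceSum : (Fin m → QVertex n) → EdgeList m → ℕ
distanceSum f E = sum (map (λ e → hamming (f (proj₁ e)) (f (proj₂ e))) E)

distanceSum-++ : (f : Fin m → QVertex n) (E F : EdgeList m) →
                 distanceSum f (E ++ F) ≡ distanceSum f E + distanceSum f F
distanceSum-++ f E F = trans (cong sum (map-++ _ E F)) (sum-++ (map _ E) (map _ F))

distanceSum-allFin : ∀ {k} (f : Fin m → QVertex n) (e : Fin k → Fin m × Fin m) →
                     distanceSum f (map e (allFin k)) ≡
                     sum (tabulate (λ i → hamming (f (proj₁ (e i))) (f (proj₂ (e i)))))
distanceSum-allFin f e = cong sum (trans (cong (map _) (map-tabulate (λ i → i) e)) (map-tabulate e _))

distanceSum≤sumLengths : {f : Fin m → QVertex n} {E : EdgeList m}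
                         (P : All (λ e → QPath (f (proj₁ e)) (f (proj₂ e))) E) →
                         distanceSum f E ≤ sumLengths P
distanceSum≤sumLengths []             = z≤n
distanceSum≤sumLengths ((w , _) ∷ P) = +-mono-≤ (hamming≤walkLength w) (distanceSum≤sumLengths P)

geodesicEmbedding : (E : EdgeList m) (f : Fin m → QVertex n) → Injective _≡_ _≡_ f → Embedding E n
geodesicEmbedding E f f-inj = record
  { f = f ; f-inj = f-inj ; P = universal (λ e → proj₁ (geodesic (f (proj₁ e)) (f (proj₂ e)))) E }

wirelength-geodesicEmbedding : (E : EdgeList m) (f : Fin m → QVertex n) (f-inj : Injective _≡_ _≡_ f) →
                               wirelength (geodesicEmbedding E f f-inj) ≡ distanceSum f E
wirelength-geodesicEmbedding []      f f-inj = refl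
wirelength-geodesicEmbedding (e ∷ E) f f-inj =
  cong₂ _+_ (proj₂ (geodesic (f (proj₁ e)) (f (proj₂ e)))) (wirelength-geodesicEmbedding E f f-inj)

spokeSum : ∀ {k} → QVertex n → (Fin k → QVertex n) → ℕ
spokeSum hub g = sum (tabulate (λ i → hamming hub (g i)))

pathDistance : (Fin (suc j) → QVertex n) → ℕ
pathDistance {j} g = sum (tabulate {n = j} (λ i → hamming (g (inject₁ i)) (g (suc i))))

cycleDistance : (Fin (suc j) → QVertex n) → ℕ
cycleDistance {j} g = pathDistance g + hamming (g (fromℕ j)) (g zero)

distanceSum-wheel : (f : Fin (suc (suc j)) → QVertex n) →
                    distanceSum f (wheelEdges j) ≡ spokeSum (f zero) (f ∘ suc) + cycleDistance (f ∘ suc)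
distanceSum-wheel {j} f = begin
  distanceSum f (spokes ++ map rim (steps ++ [ closing ]))
    ≡⟨ distanceSum-++ f spokes _ ⟩
  distanceSum f spokes + distanceSum f (map rim (steps ++ [ closing ]))
    ≡⟨ cong (distanceSum f spokes +_) (trans (cong (distanceSum f) (map-++ rim steps [ closing ]))
                                              (distanceSum-++ f (map rim steps) _)) ⟩
  distanceSum f spokes + (distanceSum f (map rim steps) + (hamming (f (suc (fromℕ j))) (f (suc zero)) + 0))
    ≡⟨ cong₂ _+_ (distanceSum-allFin f spoke)
                 (cong₂ _+_ (trans (cong (distanceSum f) (sym (map-∘ {g = rim} {f = step} (allFin j))))
                                   (distanceSum-allFin f (rim ∘ step)))
                            (+-identityʳ _)) ⟩
  spokeSum (f zero) (f ∘ suc) + cycleDistance (f ∘ suc) ∎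
  where
  open ≡-Reasoning
  spoke : Fin (suc j) → Fin (suc (suc j)) × Fin (suc (suc j))
  spoke i = zero , suc i
  step : Fin j → Fin (suc j) × Fin (suc j)
  step i = inject₁ i , suc i
  spokes = map spoke (allFin (suc j))
  steps = map step (allFin j)
  closing = (fromℕ j , zero)
  rim : Fin (suc j) × Fin (suc j) → Fin (suc (suc j)) × Fin (suc (suc j))
  rim e = suc (proj₁ e) , suc (proj₂ e)

-- Total distance from a vertex to all vertices of the cube

2^[1+n]≡2^n+2^n : ∀ n → 2 ^ suc n ≡ 2 ^ n + 2 ^ n
2^[1+n]≡2^n+2^n n = cong (2 ^ n +_) (+-identityʳ (2 ^ n))

column : Bool → List (QVertex (suc n)) → List (QVertex n)
column b []              = []
column b ((c ∷ v) ∷ vs) with c Bool.≟ b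
... | yes _ = v ∷ column b vs
... | no  _ = column b vs

length-column : (vs : List (QVertex (suc n))) → length vs ≡ length (column false vs) + length (column true vs)
length-column []                  = refl
length-column ((false ∷ v) ∷ vs) = cong suc (length-column vs)
length-column ((true ∷ v) ∷ vs)  =
  trans (cong suc (length-column vs)) (sym (+-suc (length (column false vs)) (length (column true vs))))

∉-column : ∀ {b} {v : QVertex n} {vs} → All ((b ∷ v) ≢_) vs → All (v ≢_) (column b vs)
∉-column                          []       = []
∉-column {b = b} {vs = (c ∷ w) ∷ _} (p ∷ ps) with c Bool.≟ b
... | yes refl = (λ v≡w → p (cong (c ∷_) v≡w)) ∷ ∉-column ps
... | no  _    = ∉-column ps

unique-column : ∀ b {vs : List (QVertex (suc n))} → Unique vs → Unique (column b vs)
unique-column b                         []         = []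
unique-column b {vs = (c ∷ v) ∷ _} (p ∷ uniq) with c Bool.≟ b
... | yes refl = ∉-column p ∷ unique-column b uniq
... | no  _    = unique-column b uniq

private
  suc-+-regroup : ∀ x a b c → suc (x + (a + (b + c))) ≡ a + ((x + b) + suc c)
  suc-+-regroup = solve-∀

columnSum : QVertex n → Bool → List (QVertex (suc n)) → ℕ
columnSum h b vs = sum (map (hamming h) (column b vs))

sum-hamming-column : ∀ b (h : QVertex n) vs →
  sum (map (hamming (b ∷ h)) vs) ≡ columnSum h b vs + (columnSum h (not b) vs + length (column (not b) vs))
sum-hamming-column b     h []                 = refl
sum-hamming-column false h ((false ∷ v) ∷ vs) =
  trans (cong (hamming h v +_) (sum-hamming-column false h vs)) (sym (+-assoc (hamming h v) _ _))
sum-hamming-column true  h ((true ∷ v) ∷ vs)  =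
  trans (cong (hamming h v +_) (sum-hamming-column true h vs)) (sym (+-assoc (hamming h v) _ _))
sum-hamming-column false h ((true ∷ v) ∷ vs)  =
  trans (cong (λ s → suc (hamming h v + s)) (sum-hamming-column false h vs))
        (suc-+-regroup (hamming h v) (columnSum h false vs) (columnSum h true vs) (length (column true vs)))
sum-hamming-column true  h ((false ∷ v) ∷ vs) =
  trans (cong (λ s → suc (hamming h v + s)) (sum-hamming-column true h vs))
        (suc-+-regroup (hamming h v) (columnSum h true vs) (columnSum h false vs) (length (column false vs)))

unique⇒length≤2^n : (vs : List (QVertex n)) → Unique vs → length vs ≤ 2 ^ n
unique⇒length≤2^n {zero}  []                    _                  = z≤n
unique⇒length≤2^n {zero}  (_ ∷ [])              _                  = ≤-refl
unique⇒length≤2^n {zero}  ([] ∷ [] ∷ _)         ((p ∷ _) ∷ _)      = contradiction refl p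
unique⇒length≤2^n {suc n} vs                    uniq               = begin
  length vs                                          ≡⟨ length-column vs ⟩
  length (column false vs) + length (column true vs) ≤⟨ +-mono-≤ (unique⇒length≤2^n _ (unique-column false uniq))
                                                                 (unique⇒length≤2^n _ (unique-column true uniq)) ⟩
  2 ^ n + 2 ^ n                                      ≡⟨ 2^[1+n]≡2^n+2^n n ⟨
  2 ^ suc n                                          ∎
  where open ≤-Reasoning

m+n≡o+o⇒m≡o : ∀ {m n o} → m ≤ o → n ≤ o → m + n ≡ o + o → m ≡ o
m+n≡o+o⇒m≡o {m} {n} {o} m≤o n≤o eq =
  ≤-antisym m≤o (+-cancelʳ-≤ o o m (≤-trans (≤-reflexive (sym eq)) (+-monoʳ-≤ m n≤o)))

length-column-enumeration : ∀ b {vs : List (QVertex (suc n))} →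
                            Unique vs → length vs ≡ 2 ^ suc n → length (column b vs) ≡ 2 ^ n
length-column-enumeration {n} b {vs} uniq len = full b
  where
  bound : ∀ c → length (column c vs) ≤ 2 ^ n
  bound c = unique⇒length≤2^n _ (unique-column c uniq)
  total : length (column false vs) + length (column true vs) ≡ 2 ^ n + 2 ^ n
  total = trans (sym (length-column vs)) (trans len (2^[1+n]≡2^n+2^n n))
  full : ∀ c → length (column c vs) ≡ 2 ^ n
  full false = m+n≡o+o⇒m≡o (bound false) (bound true) total
  full true  = m+n≡o+o⇒m≡o (bound true) (bound false) (trans (+-comm (length (column true vs)) _) total)

sum-hamming-enumeration : (h : QVertex n) (vs : List (QVertex n)) →
                          Unique vs → length vs ≡ 2 ^ n → 2 * sum (map (hamming h) vs) ≡ n * 2 ^ n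
sum-hamming-enumeration []      ([] ∷ [])    _    _   = refl
sum-hamming-enumeration {suc n} (b ∷ h) vs uniq len = begin
  2 * sum (map (hamming (b ∷ h)) vs)
    ≡⟨ cong (2 *_) (sum-hamming-column b h vs) ⟩
  2 * (columnSum h b vs + (columnSum h (not b) vs + length (column (not b) vs)))
    ≡⟨ cong (λ l → 2 * (columnSum h b vs + (columnSum h (not b) vs + l)))
            (length-column-enumeration (not b) uniq len) ⟩
  2 * (columnSum h b vs + (columnSum h (not b) vs + 2 ^ n))
    ≡⟨ *-distribˡ-+ 2 (columnSum h b vs) _ ⟩
  2 * columnSum h b vs + 2 * (columnSum h (not b) vs + 2 ^ n)
    ≡⟨ cong₂ _+_ (IH b) (trans (*-distribˡ-+ 2 (columnSum h (not b) vs) _) (cong (_+ 2 * 2 ^ n) (IH (not b)))) ⟩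
  n * 2 ^ n + (n * 2 ^ n + 2 * 2 ^ n)
    ≡⟨ regroup n (2 ^ n) ⟩
  suc n * 2 ^ suc n ∎
  where
  open ≡-Reasoning
  IH : ∀ c → 2 * columnSum h c vs ≡ n * 2 ^ n
  IH c = sum-hamming-enumeration h (column c vs) (unique-column c uniq) (length-column-enumeration c uniq len)
  regroup : ∀ n q → n * q + (n * q + 2 * q) ≡ suc n * (2 * q)
  regroup = solve-∀

spokeSum-enumeration : ∀ {k} (f : Fin (suc k) → QVertex n) → Injective _≡_ _≡_ f → suc k ≡ 2 ^ n →
                       2 * spokeSum (f zero) (f ∘ suc) ≡ n * 2 ^ n
spokeSum-enumeration {n} f f-inj size = begin
  2 * spokeSum (f zero) (f ∘ suc)
    ≡⟨ cong (λ d → 2 * (d + spokeSum (f zero) (f ∘ suc))) (hamming-refl (f zero)) ⟨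
  2 * sum (tabulate (hamming (f zero) ∘ f))
    ≡⟨ cong (λ l → 2 * sum l) (map-tabulate f (hamming (f zero))) ⟨
  2 * sum (map (hamming (f zero)) (tabulate f))
    ≡⟨ sum-hamming-enumeration (f zero) (tabulate f) (Unique.tabulate⁺ f-inj) (trans (length-tabulate f) size) ⟩
  n * 2 ^ n ∎
  where open ≡-Reasoning

-- Odd cycles in the cube

private
  [p+q]+[q+r]≡p+r : ∀ x y z → (x ℙ.+ y) ℙ.+ (y ℙ.+ z) ≡ x ℙ.+ z
  [p+q]+[q+r]≡p+r x y z = begin
    (x ℙ.+ y) ℙ.+ (y ℙ.+ z)  ≡⟨ ℙ.+-assoc x y (y ℙ.+ z) ⟩
    x ℙ.+ (y ℙ.+ (y ℙ.+ z))  ≡⟨ cong (x ℙ.+_) (ℙ.+-assoc y y z) ⟨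
    x ℙ.+ ((y ℙ.+ y) ℙ.+ z)  ≡⟨ cong (λ p → x ℙ.+ (p ℙ.+ z)) (ℙ.p+p≡0ℙ y) ⟩
    x ℙ.+ z                  ∎
    where open ≡-Reasoning

parity-pathDistance : (g : Fin (suc j) → QVertex n) →
                      parity (pathDistance g) ≡ vertexParity (g zero) ℙ.+ vertexParity (g (fromℕ j))
parity-pathDistance {zero}  g = sym (ℙ.p+p≡0ℙ (vertexParity (g zero)))
parity-pathDistance {suc j} g = begin
  parity (hamming (g zero) (g (suc zero)) + pathDistance (g ∘ suc))
    ≡⟨ ℙ.+-homo-+ (hamming (g zero) (g (suc zero))) (pathDistance (g ∘ suc)) ⟩
  parity (hamming (g zero) (g (suc zero))) ℙ.+ parity (pathDistance (g ∘ suc))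
    ≡⟨ cong₂ ℙ._+_ (parity-hamming (g zero) (g (suc zero))) (parity-pathDistance (g ∘ suc)) ⟩
  (p zero ℙ.+ p (suc zero)) ℙ.+ (p (suc zero) ℙ.+ p (fromℕ (suc j)))
    ≡⟨ [p+q]+[q+r]≡p+r (p zero) (p (suc zero)) (p (fromℕ (suc j))) ⟩
  p zero ℙ.+ p (fromℕ (suc j)) ∎
  where
  open ≡-Reasoning
  p = vertexParity ∘ g

parity-cycleDistance : (g : Fin (suc j) → QVertex n) → parity (cycleDistance g) ≡ 0ℙ
parity-cycleDistance {j} g = begin
  parity (pathDistance g + hamming (g (fromℕ j)) (g zero))
    ≡⟨ ℙ.+-homo-+ (pathDistance g) _ ⟩
  parity (pathDistance g) ℙ.+ parity (hamming (g (fromℕ j)) (g zero))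
    ≡⟨ cong₂ ℙ._+_ (parity-pathDistance g) (parity-hamming (g (fromℕ j)) (g zero)) ⟩
  (p zero ℙ.+ p (fromℕ j)) ℙ.+ (p (fromℕ j) ℙ.+ p zero)
    ≡⟨ [p+q]+[q+r]≡p+r (p zero) (p (fromℕ j)) (p zero) ⟩
  p zero ℙ.+ p zero
    ≡⟨ ℙ.p+p≡0ℙ (p zero) ⟩
  0ℙ ∎
  where
  open ≡-Reasoning
  p = vertexParity ∘ g

j≤pathDistance : (g : Fin (suc j) → QVertex n) → Injective _≡_ _≡_ g → j ≤ pathDistance g
j≤pathDistance {zero}  g g-inj = z≤n
j≤pathDistance {suc j} g g-inj =
  +-mono-≤ (≢⇒hamming≥1 _ _ (Fin.0≢1+n ∘ g-inj)) (j≤pathDistance (g ∘ suc) (Fin.suc-injective ∘ g-inj))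

even<⇒suc< : ∀ {m n} → parity m ≡ 0ℙ → parity n ≡ 0ℙ → m < n → suc m < n
even<⇒suc< {m} pm pn m<n with m≤n⇒m<n∨m≡n m<n
... | inj₁ 1+m<n = 1+m<n
... | inj₂ refl  = contradiction (trans (cong ℙ._⁻¹ (sym pn)) (trans (ℙ.suc-homo-⁻¹ m) pm)) λ ()

oddCycle-bound : (g : Fin (suc j) → QVertex n) → Injective _≡_ _≡_ g → 1 ≤ j → parity j ≡ 0ℙ →
                 suc (suc j) ≤ cycleDistance g
oddCycle-bound {suc j} g g-inj _ even = even<⇒suc< even (parity-cycleDistance g) (begin
  suc (suc j)                                     ≡⟨ +-comm 1 (suc j) ⟩
  suc j + 1                                       ≤⟨ +-mono-≤ (j≤pathDistance g g-inj)
                                                              (≢⇒hamming≥1 _ _ (Fin.0≢1+n ∘ sym ∘ g-inj)) ⟩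
  cycleDistance g                                 ∎)
  where open ≤-Reasoning

parity-2^[1+n] : ∀ n → parity (2 ^ suc n) ≡ 0ℙ
parity-2^[1+n] n = ℙ.*-homo-* 2 (2 ^ n)

wheel-lowerBound : ∀ n → suc (suc j) ≡ 2 ^ suc (suc n) → (emb : Embedding (wheelEdges j) (suc (suc n))) →
                   (suc (suc n) + 2) * 2 ^ suc n ≤ wirelength emb
wheel-lowerBound {j} n size emb = *-cancelˡ-≤ 2 (begin
  2 * ((N + 2) * 2 ^ suc n)                ≡⟨ regroup N (2 ^ suc n) ⟩
  N * 2 ^ N + 2 * 2 ^ N                    ≡⟨ cong₂ _+_ (spokeSum-enumeration f f-inj size) (cong (2 *_) size) ⟨
  2 * spokes + 2 * suc (suc j)             ≤⟨ +-monoʳ-≤ (2 * spokes) (*-monoʳ-≤ 2 rim≥) ⟩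
  2 * spokes + 2 * cycleDistance (f ∘ suc) ≡⟨ *-distribˡ-+ 2 spokes _ ⟨
  2 * (spokes + cycleDistance (f ∘ suc))   ≡⟨ cong (2 *_) (distanceSum-wheel f) ⟨
  2 * distanceSum f (wheelEdges j)         ≤⟨ *-monoʳ-≤ 2 (distanceSum≤sumLengths P) ⟩
  2 * wirelength emb                       ∎)
  where
  open ≤-Reasoning
  open Embedding emb
  N = suc (suc n)
  spokes = spokeSum (f zero) (f ∘ suc)
  regroup : ∀ N q → 2 * ((N + 2) * q) ≡ N * (2 * q) + 2 * (2 * q)
  regroup = solve-∀
  even : parity j ≡ 0ℙ
  even = trans (cong parity size) (parity-2^[1+n] (suc n))
  1≤j : 1 ≤ j
  1≤j = ≤-trans (n≤1+n 1) (≤-pred (≤-pred (subst (4 ≤_) (sym size) 4≤2^N)))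
    where 4≤2^N = ^-monoʳ-≤ 2 {2} {N} (s≤s (s≤s z≤n))
  rim≥ : suc (suc j) ≤ cycleDistance (f ∘ suc)
  rim≥ = oddCycle-bound (f ∘ suc) (Fin.suc-injective ∘ f-inj) 1≤j even

-- The reflected Gray code

reflect : ℕ → ℕ → ℕ
reflect q r = q ∸ suc r

reflect-< : ∀ {q r} → r < q → reflect q r < q
reflect-< r<q = ∸-monoʳ-< (s≤s z≤n) r<q

reflect-injective : ∀ {q r s} → r < q → s < q → reflect q r ≡ reflect q s → r ≡ s
reflect-injective r<q s<q eq = suc-injective (∸-cancelˡ-≡ r<q s<q eq)

reflect-suc : ∀ {q r} → suc r < q → reflect q r ≡ suc (reflect q (suc r))
reflect-suc lt = +-∸-assoc 1 lt

upperHalf-< : ∀ {q k} → q ≤ k → k < q + q → k ∸ q < q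
upperHalf-< {q} {k} q≤k k<q+q = +-cancelˡ-< q (k ∸ q) q (subst (_< q + q) (sym (m+[n∸m]≡n q≤k)) k<q+q)

gray : (n : ℕ) → ℕ → QVertex n
gray zero    k = []
gray (suc n) k with k <? 2 ^ n
... | yes _ = false ∷ gray n k
... | no  _ = true ∷ gray n (reflect (2 ^ n) (k ∸ 2 ^ n))

gray-injective : ∀ n {k l} → k < 2 ^ n → l < 2 ^ n → gray n k ≡ gray n l → k ≡ l
gray-injective zero    (s≤s z≤n) (s≤s z≤n) _ = refl
gray-injective (suc n) {k} {l} k< l< eq with k <? 2 ^ n | l <? 2 ^ n
... | yes k<q | yes l<q = gray-injective n k<q l<q (∷-injectiveʳ eq)
... | no  k≮q | no  l≮q = begin
  k                 ≡⟨ m+[n∸m]≡n (≮⇒≥ k≮q) ⟨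
  2 ^ n + (k ∸ 2 ^ n) ≡⟨ cong (2 ^ n +_) (reflect-injective k<′ l<′
                                             (gray-injective n (reflect-< k<′) (reflect-< l<′) (∷-injectiveʳ eq))) ⟩
  2 ^ n + (l ∸ 2 ^ n) ≡⟨ m+[n∸m]≡n (≮⇒≥ l≮q) ⟩
  l                 ∎
  where
  open ≡-Reasoning
  rank : ∀ {m} → m < 2 ^ suc n → m ≮ 2 ^ n → m ∸ 2 ^ n < 2 ^ n
  rank {m} m< m≮q = upperHalf-< (≮⇒≥ m≮q) (subst (m <_) (2^[1+n]≡2^n+2^n n) m<)
  k<′ = rank k< k≮q
  l<′ = rank l< l≮q

gray-adjacent : ∀ n {k} → suc k < 2 ^ n → QAdj (gray n k) (gray n (suc k))
gray-adjacent zero    (s≤s ())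
gray-adjacent (suc n) {k} 1+k< with k <? 2 ^ n | suc k <? 2 ^ n
... | yes _   | yes 1+k<q = gray-adjacent n 1+k<q
... | yes k<q | no  1+k≮q = cong suc (trans (cong (hamming (gray n k) ∘ gray n) turn) (hamming-refl (gray n k)))
  where
  turn : reflect (2 ^ n) (suc k ∸ 2 ^ n) ≡ k
  turn = trans (cong (λ q → reflect q (suc k ∸ q)) (sym (≤-antisym k<q (≮⇒≥ 1+k≮q))))
               (cong (reflect (suc k)) (n∸n≡0 (suc k)))
... | no  k≮q | yes 1+k<q = contradiction (<⇒≤ 1+k<q) k≮q
... | no  k≮q | no  1+k≮q = begin
  hamming (gray n (reflect q r)) (gray n (reflect q (suc k ∸ q)))
    ≡⟨ cong₂ (λ a b → hamming (gray n a) (gray n b))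
             (reflect-suc 1+r<q) (cong (reflect q) (+-∸-assoc 1 (≮⇒≥ k≮q))) ⟩
  hamming (gray n (suc (reflect q (suc r)))) (gray n (reflect q (suc r)))
    ≡⟨ hamming-sym (gray n (suc (reflect q (suc r)))) _ ⟩
  hamming (gray n (reflect q (suc r))) (gray n (suc (reflect q (suc r))))
    ≡⟨ gray-adjacent n (subst (_< q) (reflect-suc 1+r<q) (reflect-< r<q)) ⟩
  1 ∎
  where
  open ≡-Reasoning
  q = 2 ^ n
  r = k ∸ q
  1+r<q : suc r < q
  1+r<q = subst (_< q) (+-∸-assoc 1 (≮⇒≥ k≮q))
                (upperHalf-< (≤-trans (≮⇒≥ k≮q) (n≤1+n k)) (subst (suc k <_) (2^[1+n]≡2^n+2^n n) 1+k<))
  r<q : r < q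
  r<q = <-trans (n<1+n r) 1+r<q

gray-wraps : ∀ n {k} → suc k ≡ 2 ^ suc n → QAdj (gray (suc n) k) (gray (suc n) 0)
gray-wraps n {k} 1+k≡ with k <? 2 ^ n | 0 <? 2 ^ n
... | yes k<q | _       = contradiction k<q (<⇒≱ (subst (2 ^ n <_) (sym 1+k≡q+q) (m<m+n (2 ^ n) (m^n>0 2 n))))
  where 1+k≡q+q = trans 1+k≡ (2^[1+n]≡2^n+2^n n)
... | no  _   | no  0≮q = contradiction (m^n>0 2 n) 0≮q
... | no  k≮q | yes _   = cong suc (trans (cong (λ a → hamming (gray n a) (gray n 0)) back) (hamming-refl (gray n 0)))
  where
  q = 2 ^ n
  back : reflect q (k ∸ q) ≡ 0
  back = begin
    q ∸ suc (k ∸ q) ≡⟨ cong (q ∸_) (+-∸-assoc 1 (≮⇒≥ k≮q)) ⟨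
    q ∸ (suc k ∸ q) ≡⟨ cong (λ m → q ∸ (m ∸ q)) (trans 1+k≡ (2^[1+n]≡2^n+2^n n)) ⟩
    q ∸ (q + q ∸ q) ≡⟨ cong (q ∸_) (m+n∸m≡n q q) ⟩
    q ∸ q           ≡⟨ n∸n≡0 q ⟩
    0               ∎
    where open ≡-Reasoning

pathDistance-adjacent : (g : Fin (suc j) → QVertex n) → (∀ i → QAdj (g (inject₁ i)) (g (suc i))) →
                        pathDistance g ≡ j
pathDistance-adjacent {zero}  g adj = refl
pathDistance-adjacent {suc j} g adj = cong₂ _+_ (adj zero) (pathDistance-adjacent (g ∘ suc) (adj ∘ suc))

grayLabel : ∀ n {m} → Fin m → QVertex n
grayLabel n i = gray n (toℕ i)

grayLabel-injective : ∀ n {m} → m ≡ 2 ^ n → Injective _≡_ _≡_ (grayLabel n {m})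
grayLabel-injective n refl {i} {i′} eq = toℕ-injective (gray-injective n (toℕ<n i) (toℕ<n i′) eq)

cycleDistance-grayRim : ∀ n → suc (suc j) ≡ 2 ^ suc n →
                        cycleDistance (grayLabel (suc n) {suc (suc j)} ∘ suc) ≤ suc (suc j)
cycleDistance-grayRim {j} n size = begin
  pathDistance g + hamming (g (fromℕ j)) (g zero)              ≤⟨ +-monoʳ-≤ (pathDistance g) closing≤ ⟩
  pathDistance g + (hamming (g (fromℕ j)) hub + hamming hub (g zero))
    ≡⟨ cong₂ _+_ (pathDistance-adjacent g step)
                 (cong₂ _+_ (subst (λ m → QAdj (gray N (suc m)) hub) (sym (toℕ-fromℕ j)) (gray-wraps n size))
                            (gray-adjacent N (index< (suc zero)))) ⟩
  j + 2                                                        ≡⟨ +-comm j 2 ⟩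
  suc (suc j)                                                  ∎
  where
  open ≤-Reasoning
  N = suc n
  hub = grayLabel N {suc (suc j)} zero
  g = grayLabel N ∘ suc
  index< : (i : Fin (suc (suc j))) → toℕ i < 2 ^ N
  index< i = subst (toℕ i <_) size (toℕ<n i)
  step : ∀ i → QAdj (g (inject₁ i)) (g (suc i))
  step i rewrite toℕ-inject₁ i = gray-adjacent N (index< (suc (suc i)))
  closing≤ : hamming (g (fromℕ j)) (g zero) ≤ hamming (g (fromℕ j)) hub + hamming hub (g zero)
  closing≤ = hamming-triangle (g (fromℕ j)) hub (g zero)

wheel-upperBound : ∀ n → suc (suc j) ≡ 2 ^ suc n →
                   Σ (Embedding (wheelEdges j) (suc n)) (λ emb → wirelength emb ≤ (suc n + 2) * 2 ^ n)
wheel-upperBound {j} n size = emb , *-cancelˡ-≤ 2 (begin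
  2 * wirelength emb                  ≡⟨ cong (2 *_) (trans (wirelength-geodesicEmbedding (wheelEdges j) f f-inj)
                                                            (distanceSum-wheel f)) ⟩
  2 * (spokes + cycleDistance (f ∘ suc))   ≡⟨ *-distribˡ-+ 2 spokes _ ⟩
  2 * spokes + 2 * cycleDistance (f ∘ suc) ≤⟨ +-mono-≤ (≤-reflexive (spokeSum-enumeration f f-inj size))
                                                        (*-monoʳ-≤ 2 (cycleDistance-grayRim n size)) ⟩
  N * 2 ^ N + 2 * suc (suc j)         ≡⟨ cong (λ m → N * 2 ^ N + 2 * m) size ⟩
  N * 2 ^ N + 2 * 2 ^ N               ≡⟨ regroup N (2 ^ n) ⟩
  2 * ((N + 2) * 2 ^ n)               ∎)
  where
  open ≤-Reasoning
  N = suc n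
  f : Fin (suc (suc j)) → QVertex N
  f = grayLabel N
  f-inj : Injective _≡_ _≡_ f
  f-inj = grayLabel-injective N size
  emb = geodesicEmbedding (wheelEdges j) f f-inj
  spokes = spokeSum (f zero) (f ∘ suc)
  regroup : ∀ N q → N * (2 * q) + 2 * (2 * q) ≡ 2 * ((N + 2) * q)
  regroup = solve-∀

WLis-intro : ∀ {E : EdgeList m} {k} → ((emb : Embedding E n) → k ≤ wirelength emb) →
             Σ (Embedding E n) (λ emb → wirelength emb ≤ k) → WLis E n k
WLis-intro lower (emb , upper) = (emb , ≤-antisym upper (lower emb)) , lower

theorem7p1 : (n : ℕ) → 2 ≤ n →
    WLis (wheelEdges (2 ^ n ∸ 2)) n ((n + 2) * 2 ^ (n ∸ 1))
theorem7p1 (suc (suc n)) (s≤s (s≤s z≤n)) = WLis-intro (wheel-lowerBound n size) (wheel-upperBound (suc n) size)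
  where
  size : suc (suc (2 ^ suc (suc n) ∸ 2)) ≡ 2 ^ suc (suc n)
  size = m+[n∸m]≡n (^-monoʳ-≤ 2 {1} {suc (suc n)} (s≤s z≤n))
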